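{- Let $G$ be a bipartite graph with $q$ edges and stable sets $A_G,B_G$ that admits a bigraceful labeling $(f_{A_G},f_{B_G})$ with respect to the ordered partition $(A_G,B_G)$; identify each vertex of $A_G$ with its label under $f_{A_G}$ and each vertex of $B_G$ with its label under $f_{B_G}$. Let $n\ge1$ and let $A,B\subset[0,n-1]$ be fixed sets. Let $\Gamma$ be a family of bipartite graphs such that every $F\in\Gamma$ has exactly $n$ edges and admits a bigraceful labeling $(f_{A_F},f_{B_F})$ with respect to an ordered partition $(A_F,B_F)$ of $V(F)$ into stable sets, with $f_{A_F}(A_F)=A$ and $f_{B_F}(B_F)=B$, where $A$ and $B$ do not depend on $F$; identify the vertices of $A_F$ (resp. $B_F$) with their labels, so that every $F\in\Gamma$ has stable sets (copies of) $A$ and $B$. Let $h:E(G)\to\Gamma$ be any function. Then the graph $G\bar\otimes_h\Gamma$ admits a bigraceful labeling.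
   Context: Let $G$ be a bipartite graph with $m$ edges and stable sets $A,B$. A bigraceful labeling of $G$ (with respect to the ordered partition $(A,B)$) is a pair of injective functions $f_A:A\to[0,m-1]$, $f_B:B\to[0,m-1]$ such that the induced edge labeling $g(uv)=f_B(v)-f_A(u)$ ($u\in A$, $v\in B$) is an injective map $E(G)\to[0,m-1]$. The weak $\otimes_h$-product: given a bipartite graph $G$ with stable sets $A_G,B_G$, a family $\Gamma$ of bipartite graphs each with stable sets $A$ and $B$ (as disjoint vertex sets), and a function $h:E(G)\to\Gamma$, the graph $G\bar\otimes_h\Gamma$ has vertex set $(A_G\times A)\cup(B_G\times B)$ (the two parts regarded as disjoint), and $(a,x)\in A_G\times A$ is adjacent to $(b,y)\in B_G\times B$ if and only if $ab\in E(G)$ and $xy\in E(h(ab))$. -}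

module Defs where

open import Data.Nat using (ℕ; _≤_; _<_; _∸_)
open import Data.Bool using (Bool; true; false)
open import Data.Product using (Σ; _×_; _,_; ∃-syntax)
open import Data.Fin using (Fin; toℕ)
open import Data.Fin.Subset using (Subset; _∈_)
open import Function.Bundles using (_↔_)
open import Function.Definitions using (Injective)
open import Relation.Binary.PropositionalEquality using (_≡_; refl)

-- A bipartite graph given together with its ordered partition (VA , VB)
-- into stable sets; edges only go between VA and VB (adjacency is a
-- decidable relation VA → VB → Bool, so there are no multi-edges).
record BipGraph : Set₁ where
  field
    VA  : Set
    VB  : Set
    adj : VA → VB → Bool

open BipGraph public

Edge : BipGraph → Set
Edge G = Σ (VA G) λ a → Σ (VB G) λ b → adj G a b ≡ true

edgeA : (G : BipGraph) → Edge G → VA G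
edgeA G (a , _ , _) = a

edgeB : (G : BipGraph) → Edge G → VB G
edgeB G (_ , b , _) = b

HasEdges : BipGraph → ℕ → Set
HasEdges G m = Fin m ↔ Edge G

-- (fA , fB) is a bigraceful labeling of G (w.r.t. (VA , VB)) with m edges:
-- fA, fB injective into [0, m-1], and the induced edge labeling
-- g(ab) = fB(b) - fA(a) is a well-defined (nonnegative) injective map into [0, m-1].
IsBigraceful : (G : BipGraph) → ℕ → (VA G → ℕ) → (VB G → ℕ) → Set
IsBigraceful G m fA fB =
  (∀ a → fA a < m) × (∀ b → fB b < m) ×
  Injective _≡_ _≡_ fA × Injective _≡_ _≡_ fB ×
  (∀ (e : Edge G) → fA (edgeA G e) ≤ fB (edgeB G e)) ×
  (∀ (e : Edge G) → fB (edgeB G e) ∸ fA (edgeA G e) < m) ×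
  Injective _≡_ _≡_ (λ (e : Edge G) → fB (edgeB G e) ∸ fA (edgeA G e))

Bigraceful : (G : BipGraph) → ℕ → Set
Bigraceful G m = Σ (VA G → ℕ) λ fA → Σ (VB G → ℕ) λ fB → IsBigraceful G m fA fB

-- Elements of a subset S ⊆ [0, n-1] (vertices identified with their labels).
Elem : {n : ℕ} → Subset n → Set
Elem {n} S = Σ (Fin n) λ x → x ∈ S

label : {n : ℕ} {S : Subset n} → Elem S → ℕ
label (x , _) = toℕ x

onSets : {n : ℕ} (A B : Subset n) → (Elem A → Elem B → Bool) → BipGraph
onSets A B E = record { VA = Elem A ; VB = Elem B ; adj = E }

-- Weak ⊗_h product: (a , x) ~ (b , y) iff ab ∈ E(G) and xy ∈ E(h(ab)).
prodAdjAux : (G : BipGraph) {SA SB : Set} (h : Edge G → (SA → SB → Bool))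
  (a : VA G) (b : VB G) (x : SA) (y : SB) (w : Bool) → adj G a b ≡ w → Bool
prodAdjAux G h a b x y true  p = h (a , b , p) x y
prodAdjAux G h a b x y false p = false

weakProd : (G : BipGraph) (SA SB : Set) → (Edge G → (SA → SB → Bool)) → BipGraph
weakProd G SA SB h = record
  { VA  = VA G × SA
  ; VB  = VB G × SB
  ; adj = λ { (a , x) (b , y) → prodAdjAux G h a b x y (adj G a b) refl }
  }

-- Label a vertex (a , x) of the product by f(a) · n + ℓ(x), where f is the
-- labeling of G and ℓ the common labeling of the factors: a two-digit number
-- in base n. Each factor edge xy has label g'(xy) < n, so the product edge
-- (a , x)(b , y) over ab gets label g(ab) · n + g'(xy) without borrow. The
-- product edges correspond to pairs (edge e of G, edge of the factor at e),
-- so there are q · n of them and their labels are distinct and below q · n.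
module Submission where

open import Defs
open import Data.Nat using (ℕ; zero; suc; _+_; _*_; _∸_; _≤_; _<_; s≤s)
open import Data.Nat.Properties
open import Data.Bool using (Bool; true; false)
import Data.Bool.Properties as Bool
open import Data.Product using (Σ; _×_; ∃-syntax; _,_; proj₁; proj₂; map₁)
open import Data.Fin using (fromℕ<)
import Data.Fin.Properties as Fin
open import Data.Fin.Subset using (Subset)
open import Data.Product.Function.Dependent.Propositional using (Σ-↔)
open import Function.Base using (_∘_)
open import Function.Bundles using (_↔_; mk↔ₛ′; Inverse)
open import Function.Definitions using (Injective)
open import Function.Properties.Inverse using (↔-trans)
open import Relation.Nullary using (contradiction)
open import Relation.Binary.PropositionalEquality
open import Axiom.UniquenessOfIdentityProofs using (module Decidable⇒UIP)

n≤[1+d]*n+r : ∀ n d r → n ≤ suc d * n + r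
n≤[1+d]*n+r n d r = ≤-trans (m≤m+n n (d * n)) (m≤m+n (n + d * n) r)

*+-injective : ∀ {n} d d' {r r'} → r < n → r' < n →
               d * n + r ≡ d' * n + r' → d ≡ d' × r ≡ r'
*+-injective zero zero _ _ eq = refl , eq
*+-injective {n} zero (suc d') {r' = r'} r<n _ eq =
  contradiction (subst (n ≤_) (sym eq) (n≤[1+d]*n+r n d' r')) (<⇒≱ r<n)
*+-injective {n} (suc d) zero {r} _ r'<n eq =
  contradiction (subst (n ≤_) eq (n≤[1+d]*n+r n d r)) (<⇒≱ r'<n)
*+-injective {n} (suc d) (suc d') {r} {r'} r<n r'<n eq =
  map₁ (cong suc) (*+-injective d d' r<n r'<n
    (+-cancelˡ-≡ n _ _ (trans (sym (+-assoc n (d * n) r)) (trans eq (+-assoc n (d' * n) r')))))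

*+-∸-*+ : ∀ n {c d x y} → c ≤ d → x ≤ y →
          (d * n + y) ∸ (c * n + x) ≡ (d ∸ c) * n + (y ∸ x)
*+-∸-*+ n {zero} {d} _ x≤y = +-∸-assoc (d * n) x≤y
*+-∸-*+ n {suc c} {suc d} {x} {y} (s≤s c≤d) x≤y = begin
  (n + d * n) + y ∸ ((n + c * n) + x)  ≡⟨ cong₂ _∸_ (+-assoc n (d * n) y) (+-assoc n (c * n) x) ⟩
  n + (d * n + y) ∸ (n + (c * n + x))  ≡⟨ [m+n]∸[m+o]≡n∸o n (d * n + y) (c * n + x) ⟩
  (d * n + y) ∸ (c * n + x)            ≡⟨ *+-∸-*+ n c≤d x≤y ⟩
  (d ∸ c) * n + (y ∸ x)                ∎
  where open ≡-Reasoning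

*+<* : ∀ {n q d r} → d < q → r < n → d * n + r < q * n
*+<* {n} {d = d} d<q r<n = ≤-trans (+-monoʳ-< (d * n) r<n)
  (≤-trans (≤-reflexive (+-comm (d * n) n)) (*-monoˡ-≤ n d<q))

Bool-uip : {x y : Bool} (p q : x ≡ y) → p ≡ q
Bool-uip = Decidable⇒UIP.≡-irrelevant Bool._≟_

Edge-≡ : ∀ G {a b} {p q : adj G a b ≡ true} → _≡_ {A = Edge G} (a , b , p) (a , b , q)
Edge-≡ G {p = p} {q} = cong (λ r → _ , _ , r) (Bool-uip p q)

module IsBigracefulProps {G m fA fB} (β : IsBigraceful G m fA fB) where

  fA< : ∀ a → fA a < m
  fA< = proj₁ β

  fB< : ∀ b → fB b < m
  fB< = proj₁ (proj₂ β)

  fA-injective : Injective _≡_ _≡_ fA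
  fA-injective = proj₁ (proj₂ (proj₂ β))

  fB-injective : Injective _≡_ _≡_ fB
  fB-injective = proj₁ (proj₂ (proj₂ (proj₂ β)))

  fA≤fB : ∀ e → fA (edgeA G e) ≤ fB (edgeB G e)
  fA≤fB = proj₁ (proj₂ (proj₂ (proj₂ (proj₂ β))))

  edgeLabel< : ∀ e → fB (edgeB G e) ∸ fA (edgeA G e) < m
  edgeLabel< = proj₁ (proj₂ (proj₂ (proj₂ (proj₂ (proj₂ β)))))

  edgeLabel-injective : Injective _≡_ _≡_ (λ (e : Edge G) → fB (edgeB G e) ∸ fA (edgeA G e))
  edgeLabel-injective = proj₂ (proj₂ (proj₂ (proj₂ (proj₂ (proj₂ β)))))

digits : ∀ {X Y : Set} → ℕ → (X → ℕ) → (Y → ℕ) → X × Y → ℕ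
digits n f ℓ (a , x) = f a * n + ℓ x

onTypes : (SA SB : Set) → (SA → SB → Bool) → BipGraph
onTypes SA SB E = record { VA = SA ; VB = SB ; adj = E }

edgeAt : ∀ {G q k} → HasEdges G q → k < q → Edge G
edgeAt hasG k<q = Inverse.to hasG (fromℕ< k<q)

module WeakProduct (G : BipGraph) {SA SB : Set} (H : Edge G → SA → SB → Bool) where

  Prod : BipGraph
  Prod = weakProd G SA SB H

  Fibre : Edge G → BipGraph
  Fibre e = onTypes SA SB (H e)

  EdgePair : Set
  EdgePair = Σ (Edge G) (Edge ∘ Fibre)

  prodAdj⇒adj : ∀ a b x y w (eq : adj G a b ≡ w) → prodAdjAux G H a b x y w eq ≡ true →
                Σ (adj G a b ≡ true) λ p → H (a , b , p) x y ≡ true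
  prodAdj⇒adj a b x y true eq s = eq , s

  adj⇒prodAdj : ∀ a b x y (p : adj G a b ≡ true) → H (a , b , p) x y ≡ true →
                ∀ w (eq : adj G a b ≡ w) → prodAdjAux G H a b x y w eq ≡ true
  adj⇒prodAdj a b x y p r true eq = subst (λ p' → H (a , b , p') x y ≡ true) (Bool-uip p eq) r
  adj⇒prodAdj a b x y p r false eq with () ← trans (sym eq) p

  split : Edge Prod → EdgePair
  split ((a , x) , (b , y) , s) =
    let p , r = prodAdj⇒adj a b x y (adj G a b) refl s in (a , b , p) , (x , y , r)

  join : EdgePair → Edge Prod
  join ((a , b , p) , (x , y , r)) = (a , x) , (b , y) , adj⇒prodAdj a b x y p r (adj G a b) refl

  EdgePair-≡ : ∀ {a b x y p p'} {r : H (a , b , p) x y ≡ true} {r' : H (a , b , p') x y ≡ true} →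
               _≡_ {A = EdgePair} ((a , b , p) , (x , y , r)) ((a , b , p') , (x , y , r'))
  EdgePair-≡ {p = p} {p'} with refl ← Bool-uip p p' = cong (_ ,_) (Edge-≡ (Fibre _))

  EdgePair↔Edge : EdgePair ↔ Edge Prod
  EdgePair↔Edge = mk↔ₛ′ join split (λ _ → Edge-≡ Prod) (λ _ → EdgePair-≡)

  hasEdges : ∀ {q n} → HasEdges G q → (∀ e → HasEdges (Fibre e) n) → HasEdges Prod (q * n)
  hasEdges hasG hasH =
    ↔-trans Fin.*↔× (↔-trans (Σ-↔ hasG (hasH _)) EdgePair↔Edge)

  split-injective : Injective _≡_ _≡_ split
  split-injective eq = trans (sym (Edge-≡ Prod)) (trans (cong join eq) (Edge-≡ Prod))

  isBigraceful : ∀ {q n fA fB} {lA : SA → ℕ} {lB : SB → ℕ} →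
                 HasEdges G q → IsBigraceful G q fA fB →
                 (∀ e → IsBigraceful (Fibre e) n lA lB) →
                 IsBigraceful Prod (q * n) (digits n fA lA) (digits n fB lB)
  isBigraceful {q} {n} {fA} {fB} {lA} {lB} hasG β fibre =
    FA< , FB< , FA-injective , FB-injective , FA≤FB , prodLabel< , prodLabel-injective
    where
    open IsBigracefulProps β
    module F e = IsBigracefulProps (fibre e)

    FA : VA Prod → ℕ
    FA = digits n fA lA

    FB : VB Prod → ℕ
    FB = digits n fB lB

    -- Facts about lA and lB come from some factor; one exists since fA a < q forces q > 0.
    edgeAtA : VA G → Edge G
    edgeAtA a = edgeAt hasG (fA< a)

    edgeAtB : VB G → Edge G
    edgeAtB b = edgeAt hasG (fB< b)

    FA< : ∀ v → FA v < q * n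
    FA< (a , x) = *+<* (fA< a) (F.fA< (edgeAtA a) x)

    FB< : ∀ v → FB v < q * n
    FB< (b , y) = *+<* (fB< b) (F.fB< (edgeAtB b) y)

    FA-injective : Injective _≡_ _≡_ FA
    FA-injective {a , x} {a' , x'} eq
      with fa≡fa' , lx≡lx' ← *+-injective (fA a) (fA a') (F.fA< (edgeAtA a) x) (F.fA< (edgeAtA a) x') eq
      with refl ← fA-injective fa≡fa'
      with refl ← F.fA-injective (edgeAtA a) lx≡lx' = refl

    FB-injective : Injective _≡_ _≡_ FB
    FB-injective {b , y} {b' , y'} eq
      with fb≡fb' , ly≡ly' ← *+-injective (fB b) (fB b') (F.fB< (edgeAtB b) y) (F.fB< (edgeAtB b) y') eq
      with refl ← fB-injective fb≡fb'
      with refl ← F.fB-injective (edgeAtB b) ly≡ly' = refl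

    FA≤FB : ∀ e → FA (edgeA Prod e) ≤ FB (edgeB Prod e)
    FA≤FB e = let e₀ , k₀ = split e in +-mono-≤ (*-monoˡ-≤ n (fA≤fB e₀)) (F.fA≤fB e₀ k₀)

    prodLabel : Edge Prod → ℕ
    prodLabel e = FB (edgeB Prod e) ∸ FA (edgeA Prod e)

    pairLabel : EdgePair → ℕ
    pairLabel (e , k) = (fB (edgeB G e) ∸ fA (edgeA G e)) * n
                        + (lB (edgeB (Fibre e) k) ∸ lA (edgeA (Fibre e) k))

    prodLabel≡pairLabel : ∀ e → prodLabel e ≡ pairLabel (split e)
    prodLabel≡pairLabel e = let e₀ , k₀ = split e in *+-∸-*+ n (fA≤fB e₀) (F.fA≤fB e₀ k₀)

    pairLabel-injective : Injective _≡_ _≡_ pairLabel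
    pairLabel-injective {e , k} {e' , k'} eq
      with ge≡ge' , gk≡gk' ← *+-injective _ _ (F.edgeLabel< e k) (F.edgeLabel< e' k') eq
      with refl ← edgeLabel-injective {e} {e'} ge≡ge'
      with refl ← F.edgeLabel-injective e {k} {k'} gk≡gk' = refl

    prodLabel< : ∀ e → prodLabel e < q * n
    prodLabel< e = let e₀ , k₀ = split e in
      subst (_< q * n) (sym (prodLabel≡pairLabel e)) (*+<* (edgeLabel< e₀) (F.edgeLabel< e₀ k₀))

    prodLabel-injective : Injective _≡_ _≡_ prodLabel
    prodLabel-injective {e} {e'} eq = split-injective (pairLabel-injective (begin
      pairLabel (split e)   ≡⟨ sym (prodLabel≡pairLabel e) ⟩
      prodLabel e           ≡⟨ eq ⟩
      prodLabel e'          ≡⟨ prodLabel≡pairLabel e' ⟩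
      pairLabel (split e')  ∎))
      where open ≡-Reasoning

theorem6 : (G : BipGraph) (q : ℕ) → HasEdges G q → Bigraceful G q →
           (n : ℕ) → 1 ≤ n → (A B : Subset n) →
           (I : Set) (Γ : I → (Elem A → Elem B → Bool)) →
           (∀ i → HasEdges (onSets A B (Γ i)) n ×
                  IsBigraceful (onSets A B (Γ i)) n label label) →
           (h : Edge G → I) →
           ∃[ m ] (HasEdges (weakProd G (Elem A) (Elem B) (λ e → Γ (h e))) m ×
                   Bigraceful (weakProd G (Elem A) (Elem B) (λ e → Γ (h e))) m)
theorem6 G q hasG (fA , fB , β) n _ A B I Γ factors h =
  q * n ,
  hasEdges hasG (proj₁ ∘ factors ∘ h) ,
  digits n fA label , digits n fB label , isBigraceful hasG β (proj₂ ∘ factors ∘ h)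
  where open WeakProduct G (Γ ∘ h)
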